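{- Let $n\ge2$ and let $\lambda=(\lambda_1,\dots,\lambda_l)$ be a partition with $l=\ell(\lambda)$ positive parts, $l\le n-1$, each positive integer occurring at most twice. Then $$\mathfrak C^{n}(\lambda)=\mathfrak C^{n}(\lambda\oplus 1)+q^{\alpha_1}\,\mathfrak C^{n-1}(\lambda-\mathbf 1_l),\qquad \alpha_1=2n-2-\ell(\lambda),$$ where $\lambda\oplus1=(\lambda_1,\dots,\lambda_l,1)$ and $\lambda-\mathbf 1_l=(\lambda_1-1,\dots,\lambda_l-1)$.
   Context: For $k\ge1$: grid with $2k$ rows numbered $1,\dots,2k$ from top to bottom and $k$ columns numbered $1,\dots,k$ from left to right; box $(i,j)$ is in row $i$, column $j$. For a partition $\lambda$ (with $\lambda_i=0$ beyond its last part), a Dellac configuration of size $k$ with boundaries $\lambda$ and $\delta_{k-1}=(k-1,\dots,1)$ is a set of $2k$ boxes ("dots") such that each row contains exactly one dot, each column contains exactly two dots, no dot lies in a box $(i,j)$ with $j\le\lambda_i$ (any row $i$), and no dot lies in a box $(i,j)$ with $k+2\le i\le 2k$ and $j\ge 2k+2-i$. An inversion is a pair of dots one of which lies strictly above and strictly to the left of the other. $\mathfrak C^k(\lambda)=\sum_C q^{\mathrm{inv}(C)}$ over all such configurations. -}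

module Defs where

open import Data.Nat using (ℕ; zero; suc; _+_; _∸_; _≤_; _<_; _≤ᵇ_; _<ᵇ_; _≡ᵇ_)
open import Data.Bool using (Bool; true; false; _∧_; _∨_; not; if_then_else_)
open import Data.Fin using (Fin; toℕ)
open import Data.Fin.Properties using (_≟_)
open import Data.Vec using (Vec; []; _∷_; lookup)
open import Data.List using (List; []; _∷_; [_]; map; concatMap; filter; length; allFin; _++_; foldr)
open import Data.Product using (_×_)
open import Relation.Nullary.Decidable using (⌊_⌋)

part : List ℕ → ℕ → ℕ
part []       _       = 0
part (x ∷ xs) zero    = x
part (x ∷ xs) (suc i) = part xs i

-- A set of boxes with exactly one dot per row is encoded by the function
-- row ↦ column of its dot: a vector of length 2k of columns (Fin k).
-- Row r : Fin (2k) is row toℕ r + 1, column c : Fin k is column toℕ c + 1.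
allVecs : (k m : ℕ) → List (Vec (Fin k) m)
allVecs k zero    = [ [] ]
allVecs k (suc m) = concatMap (λ x → map (x ∷_) (allVecs k m)) (allFin k)

colCount : ∀ {k m} → Vec (Fin k) m → Fin k → ℕ
colCount []       c = 0
colCount (x ∷ xs) c = (if ⌊ x ≟ c ⌋ then 1 else 0) + colCount xs c

allB : ∀ {A : Set} → (A → Bool) → List A → Bool
allB p = foldr (λ a b → p a ∧ b) true

allowedBox : (k : ℕ) → List ℕ → ℕ → ℕ → Bool
allowedBox k λ' i j =
  not (j ≤ᵇ part λ' (i ∸ 1))
  ∧ not ((k + 2 ≤ᵇ i) ∧ (i ≤ᵇ k + k) ∧ ((k + k + 2) ∸ i ≤ᵇ j))

-- Dellac configuration of size k with boundaries λ and δ_{k-1}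
isDellac : (k : ℕ) → List ℕ → Vec (Fin k) (k + k) → Bool
isDellac k λ' v =
  allB (λ c → colCount v c ≡ᵇ 2) (allFin k)
  ∧ allB (λ r → allowedBox k λ' (suc (toℕ r)) (suc (toℕ (lookup v r)))) (allFin (k + k))

inv : ∀ {k m} → Vec (Fin k) m → ℕ
inv {k} {m} v =
  length (filter (λ p → Data.Bool.T? (pairInv p))
    (concatMap (λ r → map (λ s → (r , s)) (allFin m)) (allFin m)))
  where
    open import Data.Product using (_,_)
    pairInv : Fin m × Fin m → Bool
    pairInv (r , s) = (toℕ r <ᵇ toℕ s) ∧ (toℕ (lookup v r) <ᵇ toℕ (lookup v s))

-- The polynomial 𝔆^k(λ) ∈ ℕ[q], represented by its coefficient function:
-- DellacCoeff k λ d = coefficient of q^d = number of Dellac configurations with d inversions.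
DellacCoeff : ℕ → List ℕ → ℕ → ℕ
DellacCoeff k λ' d =
  length (filter (λ v → Data.Bool.T? (isDellac k λ' v ∧ (inv v ≡ᵇ d))) (allVecs k (k + k)))

-- coefficients of q^a · f
qShift : ℕ → (ℕ → ℕ) → ℕ → ℕ
qShift a f d = if d <ᵇ a then 0 else f (d ∸ a)

data Decreasing : List ℕ → Set where
  dec-nil  : Decreasing []
  dec-one  : ∀ x → Decreasing (x ∷ [])
  dec-cons : ∀ {x y xs} → y ≤ x → Decreasing (y ∷ xs) → Decreasing (x ∷ y ∷ xs)

data AllPos : List ℕ → Set where
  pos-nil  : AllPos []
  pos-cons : ∀ {x xs} → 0 < x → AllPos xs → AllPos (x ∷ xs)

IsPartition : List ℕ → Set
IsPartition λ' = Decreasing λ' × AllPos λ'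

multiplicity : ℕ → List ℕ → ℕ
multiplicity m []       = 0
multiplicity m (x ∷ xs) = (if m ≡ᵇ x then 1 else 0) + multiplicity m xs

_⊕1 : List ℕ → List ℕ
λ' ⊕1 = λ' ++ [ 1 ]

minus1 : List ℕ → List ℕ
minus1 = map (_∸ 1)

-- Let l = ℓ(λ) and sort the configurations counted by 𝔆ⁿ(λ) by whether the dot of row l + 1 lies in
-- column 1. If it does not, the configuration is exactly one with boundary λ ⊕ 1, which differs from λ
-- only by forbidding that box. If it does, the other dot of column 1 must be in row 2n, where the
-- staircase δ_{n-1} leaves no other box, and deleting column 1 together with these two rows is a
-- bijection onto the configurations of size n − 1 with boundary λ − 1_l. The deleted dot (l + 1, 1) lies
-- strictly above and to the left of each of the 2n − 2 − l dots in rows l + 2, …, 2n − 1, while (2n, 1)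
-- is in no inversion: this is the factor q^α₁.

module Submission where

open import Algebra.Bundles using (CommutativeMonoid)
import Algebra.Properties.CommutativeSemigroup as CommutativeSemigroupProperties
open import Data.Bool using (Bool; true; false; T; _∧_; not)
open import Data.Bool.Properties
  using (∧-zeroʳ; ∧-identityʳ; ∧-assoc; ∧-conicalˡ; ∧-conicalʳ; ∧-commutativeMonoid; T-≡)
open import Data.Fin as Fin using (Fin; zero; suc; toℕ)
import Data.Fin.Properties as Finₚ
open import Data.List
  using ( List; []; _∷_; [_]; _++_; _∷ʳ_; _∷ʳ′_; initLast; length; filter; map; concatMap
        ; cartesianProductWith; allFin; tabulate)
open import Data.List.Membership.Propositional using (_∈_)
open import Data.List.Membership.Propositional.Properties
  using (∈-filter⁺; ∈-filter⁻; ∈-map⁺; ∈-map⁻; ∈-allFin; ∈-cartesianProductWith⁺)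
open import Data.List.Membership.Propositional.Properties.WithK using (unique∧set⇒bag)
open import Data.List.Properties
  using ( length-map; length-++; filter-++; map-tabulate; tabulate-cong; map-injective
        ; ∷-injectiveˡ; ∷-injectiveʳ; ∷ʳ-injective)
open import Data.List.Relation.Binary.BagAndSetEquality using (∼bag⇒↭)
open import Data.List.Relation.Binary.Permutation.Propositional.Properties using (↭-length)
import Data.List.Relation.Unary.All as All
open import Data.List.Relation.Unary.AllPairs using ([]; _∷_)
open import Data.List.Relation.Unary.Any using (here)
open import Data.List.Relation.Unary.Unique.Propositional using (Unique)
import Data.List.Relation.Unary.Unique.Propositional.Properties as Unique
open import Data.Nat using (ℕ; zero; suc; _+_; _*_; _∸_; _≤_; _<_; _≤ᵇ_; _<ᵇ_; _≡ᵇ_; s≤s; s≤s⁻¹; z≤n)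
open import Data.Nat.ListAction using (sum)
open import Data.Nat.Properties
  using ( _≤?_; _<?_; ≤-refl; ≤-trans; ≤-reflexive; <⇒≱; ≤⇒≯; ≮⇒≥; n≤1+n; m≤m+n; m≤n+m
        ; suc-injective; ≡ᵇ⇒≡; +-suc; +-assoc; +-comm; +-identityʳ; +-monoʳ-≤; +-commutativeSemigroup
        ; +-∸-assoc; ∸-monoʳ-≤; m+n∸m≡n; m+n∸n≡m; m∸n+n≡m; *-distribˡ-∸; _≟_)
open import Data.Product using (∃; _×_; _,_; proj₁; proj₂)
open import Data.Vec using (Vec; []; _∷_; lookup; toList; fromList; cast)
open import Data.Vec.Properties
  using (∷-injective; toList-cast; toList∘fromList; toList-injective; cast-is-id; length-toList)
open import Defs
open import Function using (_∘_; id; _⇔_; mk⇔; Equivalence)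
open import Relation.Binary.PropositionalEquality
  using (_≡_; _≢_; refl; sym; trans; cong; cong₂; subst; module ≡-Reasoning)
open import Relation.Nullary.Decidable using (T?; does; yes; no; dec-true; dec-false; does-⇔)
open import Relation.Nullary.Negation using (contradiction)

open ≡-Reasoning
open CommutativeSemigroupProperties +-commutativeSemigroup using (x∙yz≈y∙xz)
module ∧ = CommutativeSemigroupProperties (CommutativeMonoid.commutativeSemigroup ∧-commutativeMonoid)

-- Counting

count : ∀ {A : Set} → (A → Bool) → List A → ℕ
count p xs = length (filter (λ x → T? (p x)) xs)

count-cong : ∀ {A : Set} {p q : A → Bool} → (∀ x → p x ≡ q x) → ∀ xs → count p xs ≡ count q xs
count-cong p≡q [] = refl
count-cong {p = p} {q} p≡q (x ∷ xs) with p x | q x | p≡q x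
... | true  | true  | refl = cong suc (count-cong p≡q xs)
... | false | false | refl = count-cong p≡q xs

count-none : ∀ {A : Set} {p : A → Bool} → (∀ x → p x ≡ false) → ∀ xs → count p xs ≡ 0
count-none none [] = refl
count-none {p = p} none (x ∷ xs) with p x | none x
... | false | refl = count-none none xs

count-all : ∀ {A : Set} {p : A → Bool} → (∀ x → p x ≡ true) → ∀ xs → count p xs ≡ length xs
count-all p≡true []       = refl
count-all {p = p} p≡true (x ∷ xs) with p x | p≡true x
... | true | refl = cong suc (count-all p≡true xs)

count-++ : ∀ {A : Set} (p : A → Bool) xs ys → count p (xs ++ ys) ≡ count p xs + count p ys
count-++ p xs ys = trans (cong length (filter-++ (T? ∘ p) xs ys)) (length-++ (filter (T? ∘ p) xs))

count-map : ∀ {A B : Set} (p : B → Bool) (f : A → B) xs → count p (map f xs) ≡ count (p ∘ f) xs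
count-map p f []       = refl
count-map p f (x ∷ xs) with p (f x)
... | true  = cong suc (count-map p f xs)
... | false = count-map p f xs

count-concatMap : ∀ {A B : Set} (p : B → Bool) (f : A → List B) xs →
  count p (concatMap f xs) ≡ sum (map (count p ∘ f) xs)
count-concatMap p f []       = refl
count-concatMap p f (x ∷ xs) =
  trans (count-++ p (f x) (concatMap f xs)) (cong (count p (f x) +_) (count-concatMap p f xs))

count-tabulate : ∀ {A B : Set} {n} (p : B → Bool) (f : A → B) (g : Fin n → A) →
  count p (tabulate (f ∘ g)) ≡ count (p ∘ f) (tabulate g)
count-tabulate p f g = trans (cong (count p) (sym (map-tabulate g f))) (count-map p f (tabulate g))

count-lookup : ∀ {A : Set} {m} (p : A → Bool) (v : Vec A m) →
  count (p ∘ lookup v) (allFin m) ≡ count p (toList v)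
count-lookup p []      = refl
count-lookup p (x ∷ v) with p x
... | true  = cong suc (trans (count-tabulate (p ∘ lookup (x ∷ v)) suc id) (count-lookup p v))
... | false = trans (count-tabulate (p ∘ lookup (x ∷ v)) suc id) (count-lookup p v)

count-partition : ∀ {A : Set} (p q : A → Bool) xs →
  count p xs ≡ count (λ x → p x ∧ not (q x)) xs + count (λ x → p x ∧ q x) xs
count-partition p q [] = refl
count-partition p q (x ∷ xs) with p x | q x
... | false | _     = count-partition p q xs
... | true  | false = cong suc (count-partition p q xs)
... | true  | true  = trans (cong suc (count-partition p q xs)) (sym (+-suc _ _))

count-bijection : ∀ {A B : Set} (p : A → Bool) (q : B → Bool) (g : B → A) {xs : List A} {ys : List B} →
  Unique xs → (∀ a → a ∈ xs) → Unique ys → (∀ b → b ∈ ys) →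
  (∀ {b b′} → g b ≡ g b′ → b ≡ b′) → (∀ b → p (g b) ≡ q b) → (∀ a → p a ≡ true → ∃ λ b → g b ≡ a) →
  count p xs ≡ count q ys
count-bijection p q g {xs} {ys} xs! xs-all ys! ys-all g-inj pg≡q p⇒img =
  trans (↭-length (∼bag⇒↭ (unique∧set⇒bag filter-unique image-unique (mk⇔ to from))))
        (length-map g (filter (T? ∘ q) ys))
  where
  filter-unique = Unique.filter⁺ (T? ∘ p) xs!
  image-unique = Unique.map⁺ g-inj (Unique.filter⁺ (T? ∘ q) ys!)
  to : ∀ {a} → a ∈ filter (T? ∘ p) xs → a ∈ map g (filter (T? ∘ q) ys)
  to {a} a∈ with ∈-filter⁻ (T? ∘ p) {xs = xs} a∈
  ... | _ , pa with p⇒img a (Equivalence.to T-≡ pa)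
  ... | b , refl = ∈-map⁺ g (∈-filter⁺ (T? ∘ q) (ys-all b) (subst T (pg≡q b) pa))
  from : ∀ {a} → a ∈ map g (filter (T? ∘ q) ys) → a ∈ filter (T? ∘ p) xs
  from a∈ with ∈-map⁻ g a∈
  ... | b , b∈ , refl =
    ∈-filter⁺ (T? ∘ p) (xs-all (g b)) (subst T (sym (pg≡q b)) (proj₂ (∈-filter⁻ (T? ∘ q) {xs = ys} b∈)))

qShift-below : ∀ {a d} (F : ℕ → ℕ) → d < a → qShift a F d ≡ 0
qShift-below {a} {d} F d<a rewrite dec-true (d <? a) d<a = refl

qShift-above : ∀ {a d} (F : ℕ → ℕ) → a ≤ d → qShift a F d ≡ F (d ∸ a)
qShift-above {a} {d} F a≤d rewrite dec-false (d <? a) (≤⇒≯ a≤d) = refl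

count-qShift : ∀ {A : Set} (p : A → Bool) (f : A → ℕ) a d xs →
  count (λ x → p x ∧ (f x + a ≡ᵇ d)) xs ≡ qShift a (λ e → count (λ x → p x ∧ (f x ≡ᵇ e)) xs) d
count-qShift p f a d xs with d <? a
... | yes d<a =
  trans (count-none (λ x → trans (cong (p x ∧_) (dec-false (f x + a ≟ d) (too-big x))) (∧-zeroʳ (p x))) xs)
        (sym (qShift-below (λ e → count (λ x → p x ∧ (f x ≡ᵇ e)) xs) d<a))
  where
  too-big : ∀ x → f x + a ≢ d
  too-big x eq = <⇒≱ d<a (≤-trans (m≤n+m a (f x)) (≤-reflexive eq))
... | no d≮a =
  trans (count-cong (λ x → cong (p x ∧_) (does-⇔ (shifted x) (f x + a ≟ d) (f x ≟ d ∸ a))) xs)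
        (sym (qShift-above (λ e → count (λ x → p x ∧ (f x ≡ᵇ e)) xs) a≤d))
  where
  a≤d = ≮⇒≥ d≮a
  shifted : ∀ x → f x + a ≡ d ⇔ f x ≡ d ∸ a
  shifted x = mk⇔ (λ eq → trans (sym (m+n∸n≡m (f x) a)) (cong (_∸ a) eq))
                  (λ eq → trans (cong (_+ a) eq) (m∸n+n≡m a≤d))

-- Enumerating vectors

concatMap-map : ∀ {A B C : Set} (f : A → B → C) xs ys →
  concatMap (λ x → map (f x) ys) xs ≡ cartesianProductWith f xs ys
concatMap-map f []       ys = refl
concatMap-map f (x ∷ xs) ys = cong (map (f x) ys ++_) (concatMap-map f xs ys)

∈-allVecs : ∀ {k m} (v : Vec (Fin k) m) → v ∈ allVecs k m
∈-allVecs []      = here refl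
∈-allVecs {k} {suc m} (x ∷ v) =
  subst (x ∷ v ∈_) (sym (concatMap-map _∷_ (allFin k) (allVecs k m)))
        (∈-cartesianProductWith⁺ _∷_ (∈-allFin x) (∈-allVecs v))

allVecs-unique : ∀ k m → Unique (allVecs k m)
allVecs-unique k zero    = All.[] ∷ []
allVecs-unique k (suc m) =
  subst Unique (sym (concatMap-map _∷_ (allFin k) (allVecs k m)))
        (Unique.cartesianProductWith⁺ _∷_ ∷-injective (Unique.tabulate⁺ id) (allVecs-unique k m))

-- Configurations as lists

dotsIn : ∀ {k} → Fin k → List (Fin k) → ℕ
dotsIn c = count (λ y → does (y Finₚ.≟ c))

colCount-toList : ∀ {k m} (v : Vec (Fin k) m) c → colCount v c ≡ dotsIn c (toList v)
colCount-toList []      c = refl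
colCount-toList (x ∷ v) c with x Finₚ.≟ c
... | yes _ = cong suc (colCount-toList v c)
... | no _  = colCount-toList v c

inversions : ∀ {k} → List (Fin k) → ℕ
inversions []      = 0
inversions (x ∷ L) = count (λ y → toℕ x <ᵇ toℕ y) L + inversions L

inversionsᵛ : ∀ {A : Set} {m} → (A → A → Bool) → Vec A m → ℕ
inversionsᵛ {m = m} _≺_ v =
  sum (tabulate λ r → count (λ s → (toℕ r <ᵇ toℕ s) ∧ (lookup v r ≺ lookup v s)) (allFin m))

inversionsᵛ-toList : ∀ {k m} (v : Vec (Fin k) m) →
  inversionsᵛ (λ x y → toℕ x <ᵇ toℕ y) v ≡ inversions (toList v)
inversionsᵛ-toList []              = refl
inversionsᵛ-toList {m = suc m} (x ∷ v) = cong₂ _+_ firstRow laterRows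
  where
  _≺_ : Fin _ → Fin _ → Bool
  a ≺ b = toℕ a <ᵇ toℕ b
  pair : Fin (suc m) → Fin (suc m) → Bool
  pair r s = (toℕ r <ᵇ toℕ s) ∧ (lookup (x ∷ v) r ≺ lookup (x ∷ v) s)
  firstRow : count (pair zero) (tabulate Fin.suc) ≡ count (x ≺_) (toList v)
  firstRow = trans (count-tabulate (pair zero) Fin.suc id) (count-lookup (x ≺_) v)
  laterRows : sum (tabulate (λ r → count (pair (Fin.suc r)) (tabulate Fin.suc))) ≡ inversions (toList v)
  laterRows = trans (cong sum (tabulate-cong (λ r → count-tabulate (pair (Fin.suc r)) Fin.suc id)))
                    (inversionsᵛ-toList v)

inv-toList : ∀ {k m} (v : Vec (Fin k) m) → inv v ≡ inversions (toList v)
inv-toList {m = m} v =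
  trans (count-concatMap isInversion pairsFrom (allFin m))
  (trans (cong sum (map-tabulate id (count isInversion ∘ pairsFrom)))
  (trans (cong sum (tabulate-cong (λ r → count-map isInversion (r ,_) (allFin m))))
         (inversionsᵛ-toList v)))
  where
  isInversion : Fin m × Fin m → Bool
  isInversion (r , s) = (toℕ r <ᵇ toℕ s) ∧ (toℕ (lookup v r) <ᵇ toℕ (lookup v s))
  pairsFrom : Fin m → List (Fin m × Fin m)
  pairsFrom r = map (r ,_) (allFin m)

allB-cong : ∀ {A : Set} {p q : A → Bool} → (∀ x → p x ≡ q x) → ∀ xs → allB p xs ≡ allB q xs
allB-cong p≡q []       = refl
allB-cong p≡q (x ∷ xs) = cong₂ _∧_ (p≡q x) (allB-cong p≡q xs)

allB-map : ∀ {A B : Set} (p : B → Bool) (f : A → B) xs → allB p (map f xs) ≡ allB (p ∘ f) xs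
allB-map p f []       = refl
allB-map p f (x ∷ xs) = cong (p (f x) ∧_) (allB-map p f xs)

allB-allFin-suc : ∀ {n} (p : Fin (suc n) → Bool) →
  allB p (allFin (suc n)) ≡ p zero ∧ allB (p ∘ Fin.suc) (allFin n)
allB-allFin-suc {n} p =
  cong (p zero ∧_) (trans (cong (allB p) (sym (map-tabulate id Fin.suc))) (allB-map p Fin.suc (allFin n)))

rowsAllowed : ∀ {A : Set} → (ℕ → A → Bool) → List A → Bool
rowsAllowed ok []      = true
rowsAllowed ok (x ∷ L) = ok 0 x ∧ rowsAllowed (ok ∘ suc) L

allB-lookup : ∀ {A : Set} {m} (ok : ℕ → A → Bool) (v : Vec A m) →
  allB (λ r → ok (toℕ r) (lookup v r)) (allFin m) ≡ rowsAllowed ok (toList v)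
allB-lookup ok []      = refl
allB-lookup ok (x ∷ v) =
  trans (allB-allFin-suc (λ r → ok (toℕ r) (lookup (x ∷ v) r)))
        (cong (ok 0 x ∧_) (allB-lookup (ok ∘ suc) v))

twoDotsPerColumn : (k : ℕ) → List (Fin k) → Bool
twoDotsPerColumn k L = allB (λ c → dotsIn c L ≡ᵇ 2) (allFin k)

-- Rows and columns count from 0 here, from 1 in allowedBox.
allowed : (k : ℕ) → List ℕ → ℕ → Fin k → Bool
allowed k λ′ i c = allowedBox k λ′ (suc i) (suc (toℕ c))

isDellacᴸ : (k : ℕ) → List ℕ → List (Fin k) → Bool
isDellacᴸ k λ′ L = twoDotsPerColumn k L ∧ rowsAllowed (allowed k λ′) L

isDellac-toList : ∀ k λ′ (v : Vec (Fin k) (k + k)) → isDellac k λ′ v ≡ isDellacᴸ k λ′ (toList v)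
isDellac-toList k λ′ v = cong₂ _∧_
  (allB-cong (λ c → cong (_≡ᵇ 2) (colCount-toList v c)) (allFin k))
  (allB-lookup (allowed k λ′) v)

-- The boundaries λ and δ

≤ᵇ-true : ∀ {m n} → m ≤ n → (m ≤ᵇ n) ≡ true
≤ᵇ-true {m} {n} = dec-true (m ≤? n)

≤ᵇ-false : ∀ {m n} → n < m → (m ≤ᵇ n) ≡ false
≤ᵇ-false {m} {n} n<m = dec-false (m ≤? n) (<⇒≱ n<m)

≤ᵇ-suc : ∀ m n → (suc m ≤ᵇ suc n) ≡ (m ≤ᵇ n)
≤ᵇ-suc m n = does-⇔ (mk⇔ s≤s⁻¹ s≤s) (suc m ≤? suc n) (m ≤? n)

≤ᵇ-pred : ∀ t p → (suc (suc t) ≤ᵇ p) ≡ (suc t ≤ᵇ p ∸ 1)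
≤ᵇ-pred t zero    = refl
≤ᵇ-pred t (suc p) = refl

-- The δ conjunct of allowedBox, which thus unfolds to not (j ≤ᵇ part λ′ (i ∸ 1)) ∧ not (belowStaircase k i j).
belowStaircase : ℕ → ℕ → ℕ → Bool
belowStaircase k i j = (k + 2 ≤ᵇ i) ∧ (i ≤ᵇ k + k) ∧ ((k + k + 2) ∸ i ≤ᵇ j)

belowStaircase-top : ∀ {k i} j → i < k + 2 → belowStaircase k i j ≡ false
belowStaircase-top j i<k+2 rewrite ≤ᵇ-false i<k+2 = refl

belowStaircase-firstColumn : ∀ k i → belowStaircase k i 1 ≡ false
belowStaircase-firstColumn k i with i ≤? k + k
... | yes i≤2k = trans (cong ((k + 2 ≤ᵇ i) ∧_) (cong₂ _∧_ (≤ᵇ-true i≤2k) (≤ᵇ-false gap≥2))) (∧-zeroʳ _)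
  where
  gap≥2 : 2 ≤ (k + k + 2) ∸ i
  gap≥2 = subst (_≤ (k + k + 2) ∸ i) (m+n∸m≡n (k + k) 2) (∸-monoʳ-≤ (k + k + 2) i≤2k)
... | no i≰2k =
  trans (cong (λ b → (k + 2 ≤ᵇ i) ∧ b ∧ ((k + k + 2) ∸ i ≤ᵇ 1)) (dec-false (i ≤? k + k) i≰2k)) (∧-zeroʳ _)

staircaseGap-suc : ∀ {k i} → i ≤ k + k + 2 → (suc k + suc k + 2) ∸ suc i ≡ suc ((k + k + 2) ∸ i)
staircaseGap-suc {k} {i} i≤ = trans (cong (λ t → t + 2 ∸ i) (+-suc k k)) (+-∸-assoc 1 i≤)

belowStaircase-suc : ∀ {k i} j → i ≤ k + k → belowStaircase (suc k) (suc i) (suc j) ≡ belowStaircase k i j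
belowStaircase-suc {k} {i} j i≤2k = cong₂ _∧_ (≤ᵇ-suc (k + 2) i) (cong₂ _∧_
  (trans (≤ᵇ-true (s≤s (≤-trans i≤2k (≤-trans (n≤1+n (k + k)) (≤-reflexive (sym (+-suc k k)))))))
         (sym (≤ᵇ-true i≤2k)))
  (trans (cong (_≤ᵇ suc j) (staircaseGap-suc (≤-trans i≤2k (m≤m+n (k + k) 2))))
         (≤ᵇ-suc ((k + k + 2) ∸ i) j)))

staircaseGap-lastRow : ∀ k → (suc k + suc k + 2) ∸ suc (suc (k + k)) ≡ 2
staircaseGap-lastRow k = trans (cong (λ t → t + 2 ∸ suc (k + k)) (+-suc k k)) (m+n∸m≡n (k + k) 2)

belowStaircase-lastRow : ∀ {k} j → 1 ≤ k → belowStaircase (suc k) (suc (suc (k + k))) (suc (suc j)) ≡ true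
belowStaircase-lastRow {k} j 1≤k rewrite
    ≤ᵇ-true {suc k + 2} {suc (suc (k + k))} (s≤s (≤-trans (≤-reflexive (+-suc k 1)) (s≤s (+-monoʳ-≤ k 1≤k))))
  | ≤ᵇ-true (≤-reflexive (cong suc (sym (+-suc k k))))
  | staircaseGap-lastRow k
  = refl

part-minus1 : ∀ λ′ i → part (minus1 λ′) i ≡ part λ′ i ∸ 1
part-minus1 []       i       = refl
part-minus1 (x ∷ λ′) zero    = refl
part-minus1 (x ∷ λ′) (suc i) = part-minus1 λ′ i

part-beyond : ∀ λ′ {i} → length λ′ ≤ i → part λ′ i ≡ 0
part-beyond []       _         = refl
part-beyond (x ∷ λ′) (s≤s len≤i) = part-beyond λ′ len≤i

part-⊕1 : ∀ λ′ {i} → i ≢ length λ′ → part (λ′ ⊕1) i ≡ part λ′ i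
part-⊕1 []       {zero}  i≢0 = contradiction refl i≢0
part-⊕1 []       {suc i} _   = refl
part-⊕1 (x ∷ λ′) {zero}  _   = refl
part-⊕1 (x ∷ λ′) {suc i} i≢  = part-⊕1 λ′ (i≢ ∘ cong suc)

part-⊕1-length : ∀ λ′ → part (λ′ ⊕1) (length λ′) ≡ 1
part-⊕1-length []       = refl
part-⊕1-length (x ∷ λ′) = part-⊕1-length λ′

isZero : ∀ {n} → Fin n → Bool
isZero zero    = true
isZero (suc _) = false

allowed-firstColumn : ∀ {k} λ′ {i} → length λ′ ≤ i → allowed (suc k) λ′ i zero ≡ true
allowed-firstColumn {k} λ′ {i} len≤i
  rewrite part-beyond λ′ len≤i | belowStaircase-firstColumn (suc k) (suc i) = refl

allowed-top : ∀ {k} λ′ {i} (c : Fin k) → i < k → allowed (suc k) λ′ i (suc c) ≡ allowed k (minus1 λ′) i c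
allowed-top {k} λ′ {i} c i<k rewrite part-minus1 λ′ i = cong₂ _∧_ (cong not (≤ᵇ-pred (toℕ c) (part λ′ i)))
  (trans (cong not (belowStaircase-top {suc k} (suc (suc (toℕ c))) (s≤s (≤-trans i<k (m≤m+n k 2)))))
         (sym (cong not (belowStaircase-top {k} (suc (toℕ c)) suc[i]<k+2))))
  where
  suc[i]<k+2 : suc i < k + 2
  suc[i]<k+2 = ≤-trans (s≤s i<k) (≤-trans (n≤1+n (suc k)) (≤-reflexive (+-comm 2 k)))

allowed-bottom : ∀ {k} λ′ {i} (c : Fin k) → length λ′ ≤ i → i < k + k →
  allowed (suc k) λ′ (suc i) (suc c) ≡ allowed k (minus1 λ′) i c
allowed-bottom {k} λ′ {i} c len≤i i<2k
  rewrite part-beyond λ′ (≤-trans len≤i (n≤1+n i))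
        | part-beyond (minus1 λ′) (subst (_≤ i) (sym (length-map (_∸ 1) λ′)) len≤i)
  = cong not (belowStaircase-suc {k} (suc (toℕ c)) i<2k)

allowed-lastRow : ∀ {k} λ′ (c : Fin k) → 1 ≤ k → allowed (suc k) λ′ (suc (k + k)) (suc c) ≡ false
allowed-lastRow λ′ c 1≤k rewrite belowStaircase-lastRow (toℕ c) 1≤k = ∧-zeroʳ _

allowed-⊕1 : ∀ {k} λ′ (c : Fin k) →
  allowed k (λ′ ⊕1) (length λ′) c ≡ allowed k λ′ (length λ′) c ∧ not (isZero c)
allowed-⊕1 λ′ zero    rewrite part-⊕1-length λ′ | part-beyond λ′ {length λ′} ≤-refl = sym (∧-zeroʳ _)
allowed-⊕1 λ′ (suc c) rewrite part-⊕1-length λ′ | part-beyond λ′ {length λ′} ≤-refl = sym (∧-identityʳ _)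

allowed-⊕1-other : ∀ {k} λ′ {i} (c : Fin k) → i ≢ length λ′ → allowed k (λ′ ⊕1) i c ≡ allowed k λ′ i c
allowed-⊕1-other λ′ c i≢len rewrite part-⊕1 λ′ i≢len = refl

-- Row conditions

rowsAllowed-cong : ∀ {A : Set} {okA okB : ℕ → A → Bool} → (∀ i x → okA i x ≡ okB i x) →
  ∀ L → rowsAllowed okA L ≡ rowsAllowed okB L
rowsAllowed-cong agree []      = refl
rowsAllowed-cong agree (x ∷ L) = cong₂ _∧_ (agree 0 x) (rowsAllowed-cong (λ i → agree (suc i)) L)

rowsAllowed-∷ʳ : ∀ {A : Set} (ok : ℕ → A → Bool) L x →
  rowsAllowed ok (L ∷ʳ x) ≡ rowsAllowed ok L ∧ ok (length L) x
rowsAllowed-∷ʳ ok []      x = ∧-identityʳ _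
rowsAllowed-∷ʳ ok (y ∷ L) x =
  trans (cong (ok 0 y ∧_) (rowsAllowed-∷ʳ (ok ∘ suc) L x)) (sym (∧-assoc (ok 0 y) _ _))

rowsAllowed-map : ∀ {A B : Set} (okA : ℕ → A → Bool) (okB : ℕ → B → Bool) (f : B → A) L →
  (∀ i x → i < length L → okA i (f x) ≡ okB i x) →
  rowsAllowed okA (map f L) ≡ rowsAllowed okB L
rowsAllowed-map okA okB f []      _ = refl
rowsAllowed-map okA okB f (x ∷ L) agree = cong₂ _∧_ (agree 0 x (s≤s z≤n))
  (rowsAllowed-map (okA ∘ suc) (okB ∘ suc) f L (λ i y i< → agree (suc i) y (s≤s i<)))

insertAt : ∀ {A : Set} → ℕ → A → List A → List A
insertAt zero    a xs       = a ∷ xs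
insertAt (suc j) a []       = a ∷ []
insertAt (suc j) a (x ∷ xs) = x ∷ insertAt j a xs

rowsAllowed-insertAt : ∀ {A B : Set} (okA : ℕ → A → Bool) (okB : ℕ → B → Bool) (f : B → A) a j L →
  j ≤ length L → okA j a ≡ true →
  (∀ i x → i < j → okA i (f x) ≡ okB i x) →
  (∀ i x → j ≤ i → i < length L → okA (suc i) (f x) ≡ okB i x) →
  rowsAllowed okA (insertAt j a (map f L)) ≡ rowsAllowed okB L
rowsAllowed-insertAt okA okB f a zero L _ a-ok _ below =
  cong₂ _∧_ a-ok (rowsAllowed-map (okA ∘ suc) okB f L (λ i x → below i x z≤n))
rowsAllowed-insertAt okA okB f a (suc j) (x ∷ L) (s≤s j≤len) a-ok above below =
  cong₂ _∧_ (above 0 x (s≤s z≤n))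
  (rowsAllowed-insertAt (okA ∘ suc) (okB ∘ suc) f a j L j≤len a-ok
    (λ i y i< → above (suc i) y (s≤s i<)) (λ i y j≤i i< → below (suc i) y (s≤s j≤i) (s≤s i<)))

firstColumnAt : ∀ {k} → ℕ → List (Fin k) → Bool
firstColumnAt _       []      = false
firstColumnAt zero    (x ∷ _) = isZero x
firstColumnAt (suc i) (_ ∷ L) = firstColumnAt i L

rowsAllowed-forbidFirstColumnAt : ∀ {k} (okA okB : ℕ → Fin k → Bool) l L → l < length L →
  (∀ i x → i ≢ l → okA i x ≡ okB i x) → (∀ x → okA l x ≡ okB l x ∧ not (isZero x)) →
  rowsAllowed okA L ≡ rowsAllowed okB L ∧ not (firstColumnAt l L)
rowsAllowed-forbidFirstColumnAt okA okB zero (x ∷ L) _ elsewhere atRow = trans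
  (cong₂ _∧_ (atRow x) (rowsAllowed-cong (λ i y → elsewhere (suc i) y λ ()) L))
  (∧.xy∙z≈xz∙y (okB 0 x) _ _)
rowsAllowed-forbidFirstColumnAt okA okB (suc l) (x ∷ L) (s≤s l<len) elsewhere atRow = trans
  (cong₂ _∧_ (elsewhere 0 x λ ())
    (rowsAllowed-forbidFirstColumnAt (okA ∘ suc) (okB ∘ suc) l L l<len
      (λ i y i≢l → elsewhere (suc i) y (i≢l ∘ suc-injective)) atRow))
  (sym (∧-assoc (okB 0 x) _ _))

isDellacᴸ-⊕1 : ∀ {k} λ′ (L : List (Fin k)) → length λ′ < length L →
  isDellacᴸ k (λ′ ⊕1) L ≡ isDellacᴸ k λ′ L ∧ not (firstColumnAt (length λ′) L)
isDellacᴸ-⊕1 {k} λ′ L l<len = trans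
  (cong (twoDotsPerColumn k L ∧_)
    (rowsAllowed-forbidFirstColumnAt (allowed k (λ′ ⊕1)) (allowed k λ′) (length λ′) L l<len
      (λ i x i≢l → allowed-⊕1-other λ′ x i≢l) (allowed-⊕1 λ′)))
  (sym (∧-assoc (twoDotsPerColumn k L) _ _))

-- Adding a first column

addColumn : ∀ {k} → ℕ → List (Fin k) → List (Fin (suc k))
addColumn l L = insertAt l zero (map suc L) ∷ʳ zero

length-insertAt : ∀ {A : Set} j (a : A) xs → length (insertAt j a xs) ≡ suc (length xs)
length-insertAt zero    a xs       = refl
length-insertAt (suc j) a []       = refl
length-insertAt (suc j) a (x ∷ xs) = cong suc (length-insertAt j a xs)

length-addColumn : ∀ {k} l (L : List (Fin k)) → length (addColumn l L) ≡ suc (suc (length L))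
length-addColumn l L = trans (length-++ (insertAt l zero (map suc L)))
  (trans (+-comm _ 1) (cong suc (trans (length-insertAt l zero (map suc L)) (cong suc (length-map suc L)))))

count-insertAt : ∀ {A : Set} (p : A → Bool) j a xs → count p (insertAt j a xs) ≡ count p (a ∷ xs)
count-insertAt p zero    a xs       = refl
count-insertAt p (suc j) a []       = refl
count-insertAt p (suc j) a (x ∷ xs) = begin
  count p (x ∷ insertAt j a xs)           ≡⟨ count-++ p [ x ] (insertAt j a xs) ⟩
  # x + count p (insertAt j a xs)         ≡⟨ cong (# x +_) (count-insertAt p j a xs) ⟩
  # x + count p (a ∷ xs)                  ≡⟨ cong (# x +_) (count-++ p [ a ] xs) ⟩
  # x + (# a + count p xs)                ≡⟨ x∙yz≈y∙xz (# x) (# a) _ ⟩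
  # a + (# x + count p xs)                ≡⟨ cong (# a +_) (count-++ p [ x ] xs) ⟨
  # a + count p (x ∷ xs)                  ≡⟨ count-++ p [ a ] (x ∷ xs) ⟨
  count p (a ∷ x ∷ xs)                    ∎
  where
  # : _ → ℕ
  # y = count p [ y ]

dotsIn-addColumn-zero : ∀ {k} l (L : List (Fin k)) → dotsIn zero (addColumn l L) ≡ 2
dotsIn-addColumn-zero l L = begin
  dotsIn zero (L′ ∷ʳ zero)           ≡⟨ count-++ _ L′ [ zero ] ⟩
  dotsIn zero L′ + 1                 ≡⟨ cong (_+ 1) (count-insertAt _ l zero (map suc L)) ⟩
  suc (dotsIn zero (map suc L)) + 1  ≡⟨ cong (λ n → suc n + 1) (count-map _ suc L) ⟩
  suc (count (λ _ → false) L) + 1    ≡⟨ cong (λ n → suc n + 1) (count-none (λ _ → refl) L) ⟩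
  2                                  ∎
  where
  L′ = insertAt l zero (map suc L)

dotsIn-addColumn-suc : ∀ {k} l (L : List (Fin k)) c → dotsIn (suc c) (addColumn l L) ≡ dotsIn c L
dotsIn-addColumn-suc l L c = begin
  dotsIn (suc c) (L′ ∷ʳ zero)   ≡⟨ count-++ _ L′ [ zero ] ⟩
  dotsIn (suc c) L′ + 0         ≡⟨ +-identityʳ _ ⟩
  dotsIn (suc c) L′             ≡⟨ count-insertAt _ l zero (map suc L) ⟩
  dotsIn (suc c) (map suc L)    ≡⟨ count-map _ suc L ⟩
  dotsIn c L                    ∎
  where
  L′ = insertAt l zero (map suc L)

twoDotsPerColumn-addColumn : ∀ {k} l (L : List (Fin k)) →
  twoDotsPerColumn (suc k) (addColumn l L) ≡ twoDotsPerColumn k L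
twoDotsPerColumn-addColumn {k} l L = trans (allB-allFin-suc (λ c → dotsIn c (addColumn l L) ≡ᵇ 2)) (cong₂ _∧_
  (cong (_≡ᵇ 2) (dotsIn-addColumn-zero l L))
  (allB-cong (λ c → cong (_≡ᵇ 2) (dotsIn-addColumn-suc l L c)) (allFin k)))

inversions-∷ʳ-zero : ∀ {k} (L : List (Fin (suc k))) → inversions (L ∷ʳ zero) ≡ inversions L
inversions-∷ʳ-zero []      = refl
inversions-∷ʳ-zero (x ∷ L) =
  cong₂ _+_ (trans (count-++ _ L [ zero ]) (+-identityʳ _)) (inversions-∷ʳ-zero L)

inversions-map-suc : ∀ {k} (L : List (Fin k)) → inversions (map suc L) ≡ inversions L
inversions-map-suc []      = refl
inversions-map-suc (x ∷ L) = cong₂ _+_ (count-map _ suc L) (inversions-map-suc L)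

inversions-insertAt : ∀ {k} j (L : List (Fin k)) → j ≤ length L →
  inversions (insertAt j zero (map suc L)) ≡ inversions L + (length L ∸ j)
inversions-insertAt zero L _ = trans
  (cong₂ _+_ (trans (count-map _ suc L) (count-all (λ _ → refl) L)) (inversions-map-suc L))
  (+-comm (length L) _)
inversions-insertAt (suc j) (x ∷ L) (s≤s j≤len) = trans
  (cong₂ _+_ (trans (count-insertAt _ j zero (map suc L)) (count-map _ suc L)) (inversions-insertAt j L j≤len))
  (sym (+-assoc (count (λ y → toℕ x <ᵇ toℕ y) L) (inversions L) (length L ∸ j)))

inversions-addColumn : ∀ {k} l (L : List (Fin k)) → l ≤ length L →
  inversions (addColumn l L) ≡ inversions L + (length L ∸ l)
inversions-addColumn l L l≤len =
  trans (inversions-∷ʳ-zero (insertAt l zero (map suc L))) (inversions-insertAt l L l≤len)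

rowsAllowed-addColumn : ∀ {k} λ′ (L : List (Fin k)) → length λ′ ≤ k → length L ≡ k + k →
  rowsAllowed (allowed (suc k) λ′) (addColumn (length λ′) L) ≡ rowsAllowed (allowed k (minus1 λ′)) L
rowsAllowed-addColumn {k} λ′ L l≤k len≡ = begin
  rowsAllowed A (L′ ∷ʳ zero)               ≡⟨ rowsAllowed-∷ʳ A L′ zero ⟩
  rowsAllowed A L′ ∧ A (length L′) zero    ≡⟨ cong₂ _∧_ insertedRows (allowed-firstColumn {k} λ′ l≤lastRow) ⟩
  rowsAllowed B L ∧ true                   ≡⟨ ∧-identityʳ _ ⟩
  rowsAllowed B L                          ∎
  where
  l = length λ′
  A = allowed (suc k) λ′
  B = allowed k (minus1 λ′)
  L′ = insertAt l zero (map suc L)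
  l≤len : l ≤ length L
  l≤len = ≤-trans l≤k (≤-trans (m≤m+n k k) (≤-reflexive (sym len≡)))
  l≤lastRow : l ≤ length L′
  l≤lastRow = subst (l ≤_) (sym (trans (length-insertAt l zero (map suc L)) (cong suc (length-map suc L))))
                    (≤-trans l≤len (n≤1+n _))
  insertedRows : rowsAllowed A L′ ≡ rowsAllowed B L
  insertedRows = rowsAllowed-insertAt A B suc zero l L l≤len
    (allowed-firstColumn {k} λ′ ≤-refl)
    (λ i x i<l → allowed-top λ′ x (≤-trans i<l l≤k))
    (λ i x l≤i i< → allowed-bottom λ′ x l≤i (subst (i <_) len≡ i<))

isDellacᴸ-addColumn : ∀ {k} λ′ (L : List (Fin k)) → length λ′ ≤ k → length L ≡ k + k →
  isDellacᴸ (suc k) λ′ (addColumn (length λ′) L) ≡ isDellacᴸ k (minus1 λ′) L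
isDellacᴸ-addColumn λ′ L l≤k len≡ =
  cong₂ _∧_ (twoDotsPerColumn-addColumn (length λ′) L) (rowsAllowed-addColumn λ′ L l≤k len≡)

firstColumnAt-insertAt : ∀ {k} j (L : List (Fin (suc k))) → j ≤ length L →
  firstColumnAt j (insertAt j zero L) ≡ true
firstColumnAt-insertAt zero    L       _          = refl
firstColumnAt-insertAt (suc j) (x ∷ L) (s≤s j≤len) = firstColumnAt-insertAt j L j≤len

firstColumnAt-++ : ∀ {k} j (L L′ : List (Fin k)) → j < length L → firstColumnAt j (L ++ L′) ≡ firstColumnAt j L
firstColumnAt-++ zero    (x ∷ L) L′ _           = refl
firstColumnAt-++ (suc j) (x ∷ L) L′ (s≤s j<len) = firstColumnAt-++ j L L′ j<len

firstColumnAt-addColumn : ∀ {k} l (L : List (Fin k)) → l ≤ length L → firstColumnAt l (addColumn l L) ≡ true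
firstColumnAt-addColumn l L l≤len = trans
  (firstColumnAt-++ l L′ [ zero ] (subst (l <_) (sym (length-insertAt l zero (map suc L))) (s≤s l≤mapLen)))
  (firstColumnAt-insertAt l (map suc L) l≤mapLen)
  where
  L′ = insertAt l zero (map suc L)
  l≤mapLen = subst (l ≤_) (sym (length-map suc L)) l≤len

insertAt-injective : ∀ {A : Set} j (a : A) xs ys → insertAt j a xs ≡ insertAt j a ys → xs ≡ ys
insertAt-injective zero    a xs       ys       eq = ∷-injectiveʳ eq
insertAt-injective (suc j) a []       []       eq = refl
insertAt-injective (suc j) a []       (y ∷ ys) eq
  with () ← trans (cong length (∷-injectiveʳ eq)) (length-insertAt j a ys)
insertAt-injective (suc j) a (x ∷ xs) []       eq
  with () ← trans (cong length (sym (∷-injectiveʳ eq))) (length-insertAt j a xs)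
insertAt-injective (suc j) a (x ∷ xs) (y ∷ ys) eq =
  cong₂ _∷_ (∷-injectiveˡ eq) (insertAt-injective j a xs ys (∷-injectiveʳ eq))

addColumn-injective : ∀ {k} l (L L′ : List (Fin k)) → addColumn l L ≡ addColumn l L′ → L ≡ L′
addColumn-injective l L L′ eq = map-injective Finₚ.suc-injective
  (insertAt-injective l zero (map suc L) (map suc L′) (proj₁ (∷ʳ-injective _ _ eq)))

map-suc-surjective : ∀ {k} (L : List (Fin (suc k))) → dotsIn zero L ≡ 0 → ∃ λ L′ → map suc L′ ≡ L
map-suc-surjective []          _    = [] , refl
map-suc-surjective (suc x ∷ L) none with L′ , refl ← map-suc-surjective L none = x ∷ L′ , refl

firstColumnAt⇒dotsIn : ∀ {k} j (L : List (Fin (suc k))) → firstColumnAt j L ≡ true → 0 < dotsIn zero L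
firstColumnAt⇒dotsIn zero    (zero ∷ L)  _  = s≤s z≤n
firstColumnAt⇒dotsIn (suc j) (zero ∷ L)  _  = s≤s z≤n
firstColumnAt⇒dotsIn (suc j) (suc x ∷ L) at = firstColumnAt⇒dotsIn j L at

insertAt-surjective : ∀ {k} j (L : List (Fin (suc k))) → dotsIn zero L ≡ 1 → firstColumnAt j L ≡ true →
  ∃ λ L′ → insertAt j zero (map suc L′) ≡ L
insertAt-surjective zero    (zero ∷ L)  one _
  with L′ , refl ← map-suc-surjective L (suc-injective one) = L′ , refl
insertAt-surjective (suc j) (zero ∷ L)  one at
  with () ← subst (0 <_) (suc-injective one) (firstColumnAt⇒dotsIn j L at)
insertAt-surjective (suc j) (suc x ∷ L) one at
  with L′ , refl ← insertAt-surjective j L one at = x ∷ L′ , refl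

rowsAllowed-lastRow : ∀ {k} λ′ (L : List (Fin (suc k))) c → 1 ≤ k → length L ≡ suc (k + k) →
  rowsAllowed (allowed (suc k) λ′) (L ∷ʳ suc c) ≡ false
rowsAllowed-lastRow {k} λ′ L c 1≤k len≡ = begin
  rowsAllowed A (L ∷ʳ suc c)                   ≡⟨ rowsAllowed-∷ʳ A L (suc c) ⟩
  rowsAllowed A L ∧ A (length L) (suc c)       ≡⟨ cong (λ i → rowsAllowed A L ∧ A i (suc c)) len≡ ⟩
  rowsAllowed A L ∧ A (suc (k + k)) (suc c)    ≡⟨ cong (rowsAllowed A L ∧_) (allowed-lastRow λ′ c 1≤k) ⟩
  rowsAllowed A L ∧ false                      ≡⟨ ∧-zeroʳ _ ⟩
  false                                        ∎
  where
  A = allowed (suc k) λ′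

lastDot-firstColumn : ∀ {k} λ′ (L : List (Fin (suc k))) y → 1 ≤ k → length L ≡ suc (k + k) →
  rowsAllowed (allowed (suc k) λ′) (L ∷ʳ y) ≡ true → y ≡ zero
lastDot-firstColumn λ′ L zero    1≤k len≡ rows = refl
lastDot-firstColumn λ′ L (suc c) 1≤k len≡ rows
  with () ← trans (sym rows) (rowsAllowed-lastRow λ′ L c 1≤k len≡)

length-init : ∀ {A : Set} {k} (L : List A) y → length (L ∷ʳ y) ≡ suc k + suc k → length L ≡ suc (k + k)
length-init {k = k} L y len≡ =
  suc-injective (trans (trans (+-comm 1 _) (sym (length-++ L))) (trans len≡ (cong suc (+-suc k k))))

dotsIn-zero-init : ∀ {k} (L : List (Fin (suc k))) → twoDotsPerColumn (suc k) (L ∷ʳ zero) ≡ true →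
  dotsIn zero L ≡ 1
dotsIn-zero-init L two = suc-injective (trans (+-comm 1 _) (trans (sym (count-++ _ L [ zero ])) firstColumn))
  where
  twoDots : Fin _ → Bool
  twoDots c = dotsIn c (L ∷ʳ zero) ≡ᵇ 2
  firstColumn : dotsIn zero (L ∷ʳ zero) ≡ 2
  firstColumn = ≡ᵇ⇒≡ _ 2 (subst T (sym (∧-conicalˡ _ _ (trans (sym (allB-allFin-suc twoDots)) two))) _)

addColumn-surjective : ∀ {k} λ′ (L : List (Fin (suc k))) → 1 ≤ k → length λ′ ≤ k →
  length L ≡ suc k + suc k → isDellacᴸ (suc k) λ′ L ≡ true → firstColumnAt (length λ′) L ≡ true →
  ∃ λ L′ → addColumn (length λ′) L′ ≡ L
addColumn-surjective {k} λ′ L 1≤k l≤k len≡ dellac at with initLast L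
... | L₀ ∷ʳ′ y with refl ← lastDot-firstColumn λ′ L₀ y 1≤k (length-init L₀ y len≡) (∧-conicalʳ _ _ dellac)
  with L′ , eq ← insertAt-surjective (length λ′) L₀ (dotsIn-zero-init L₀ (∧-conicalˡ _ _ dellac))
         (trans (sym (firstColumnAt-++ (length λ′) L₀ [ zero ]
           (subst (length λ′ <_) (sym (length-init L₀ y len≡)) (s≤s (≤-trans l≤k (m≤m+n k k)))))) at)
  = L′ , cong (_∷ʳ zero) eq

-- The recursion

toList-cast-fromList : ∀ {A : Set} {n} (L : List A) (eq : length L ≡ n) → toList (cast eq (fromList L)) ≡ L
toList-cast-fromList L eq = trans (toList-cast eq (fromList L)) (toList∘fromList L)

toList-injective′ : ∀ {A : Set} {n} (v w : Vec A n) → toList v ≡ toList w → v ≡ w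
toList-injective′ v w eq = trans (sym (cast-is-id refl v)) (toList-injective refl v w eq)

twice-suc : ∀ k → suc (suc (k + k)) ≡ suc k + suc k
twice-suc k = cong suc (sym (+-suc k k))

length-addColumn-toList : ∀ {k} l (w : Vec (Fin k) (k + k)) → length (addColumn l (toList w)) ≡ suc k + suc k
length-addColumn-toList {k} l w =
  trans (length-addColumn l (toList w)) (trans (cong (2 +_) (length-toList w)) (twice-suc k))

addColumnᵛ : ∀ {k} → ℕ → Vec (Fin k) (k + k) → Vec (Fin (suc k)) (suc k + suc k)
addColumnᵛ l w = cast (length-addColumn-toList l w) (fromList (addColumn l (toList w)))

toList-addColumnᵛ : ∀ {k} l (w : Vec (Fin k) (k + k)) → toList (addColumnᵛ l w) ≡ addColumn l (toList w)
toList-addColumnᵛ l w = toList-cast-fromList (addColumn l (toList w)) (length-addColumn-toList l w)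

addColumnᵛ-injective : ∀ {k} l (w w′ : Vec (Fin k) (k + k)) → addColumnᵛ l w ≡ addColumnᵛ l w′ → w ≡ w′
addColumnᵛ-injective l w w′ eq = toList-injective′ w w′ (addColumn-injective l (toList w) (toList w′)
  (trans (sym (toList-addColumnᵛ l w)) (trans (cong toList eq) (toList-addColumnᵛ l w′))))

addColumnᵛ-surjective : ∀ {k} λ′ (v : Vec (Fin (suc k)) (suc k + suc k)) → 1 ≤ k → length λ′ ≤ k →
  isDellac (suc k) λ′ v ≡ true → firstColumnAt (length λ′) (toList v) ≡ true →
  ∃ λ w → addColumnᵛ (length λ′) w ≡ v
addColumnᵛ-surjective {k} λ′ v 1≤k l≤k dellac at
  with L′ , eq ← addColumn-surjective λ′ (toList v) 1≤k l≤k (length-toList v)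
                   (trans (sym (isDellac-toList (suc k) λ′ v)) dellac) at
  = w , toList-injective′ (addColumnᵛ l w) v (begin
      toList (addColumnᵛ l w) ≡⟨ toList-addColumnᵛ l w ⟩
      addColumn l (toList w)  ≡⟨ cong (addColumn l) (toList-cast-fromList L′ lengthOk) ⟩
      addColumn l L′          ≡⟨ eq ⟩
      toList v                ∎)
  where
  l = length λ′
  lengthOk : length L′ ≡ k + k
  lengthOk = suc-injective (suc-injective (trans (sym (length-addColumn l L′))
    (trans (cong length eq) (trans (length-toList v) (sym (twice-suc k))))))
  w = cast lengthOk (fromList L′)

l≤length-toList : ∀ {A : Set} {k l} (w : Vec A (k + k)) → l ≤ k → l ≤ length (toList w)
l≤length-toList {k = k} w l≤k = subst (_ ≤_) (sym (length-toList w)) (≤-trans l≤k (m≤m+n k k))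

isDellac-⊕1 : ∀ {k} λ′ (v : Vec (Fin (suc k)) (suc k + suc k)) → length λ′ ≤ k →
  isDellac (suc k) (λ′ ⊕1) v ≡ isDellac (suc k) λ′ v ∧ not (firstColumnAt (length λ′) (toList v))
isDellac-⊕1 {k} λ′ v l≤k = begin
  isDellac (suc k) (λ′ ⊕1) v               ≡⟨ isDellac-toList (suc k) (λ′ ⊕1) v ⟩
  isDellacᴸ (suc k) (λ′ ⊕1) (toList v)     ≡⟨ isDellacᴸ-⊕1 λ′ (toList v) l<len ⟩
  isDellacᴸ (suc k) λ′ (toList v) ∧ free   ≡⟨ cong (_∧ free) (isDellac-toList (suc k) λ′ v) ⟨
  isDellac (suc k) λ′ v ∧ free             ∎
  where
  l = length λ′
  free = not (firstColumnAt l (toList v))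
  l<len : l < length (toList v)
  l<len = subst (l <_) (sym (length-toList v)) (s≤s (≤-trans l≤k (m≤m+n k (suc k))))

isDellac-addColumnᵛ : ∀ {k} λ′ (w : Vec (Fin k) (k + k)) → length λ′ ≤ k →
  isDellac (suc k) λ′ (addColumnᵛ (length λ′) w) ≡ isDellac k (minus1 λ′) w
isDellac-addColumnᵛ {k} λ′ w l≤k = begin
  isDellac (suc k) λ′ (addColumnᵛ l w)             ≡⟨ isDellac-toList (suc k) λ′ (addColumnᵛ l w) ⟩
  isDellacᴸ (suc k) λ′ (toList (addColumnᵛ l w))   ≡⟨ cong (isDellacᴸ (suc k) λ′) (toList-addColumnᵛ l w) ⟩
  isDellacᴸ (suc k) λ′ (addColumn l (toList w))    ≡⟨ isDellacᴸ-addColumn λ′ (toList w) l≤k (length-toList w) ⟩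
  isDellacᴸ k (minus1 λ′) (toList w)               ≡⟨ isDellac-toList k (minus1 λ′) w ⟨
  isDellac k (minus1 λ′) w                         ∎
  where
  l = length λ′

inv-addColumnᵛ : ∀ {k} l (w : Vec (Fin k) (k + k)) → l ≤ k → inv (addColumnᵛ l w) ≡ inv w + (k + k ∸ l)
inv-addColumnᵛ {k} l w l≤k = begin
  inv (addColumnᵛ l w)                             ≡⟨ inv-toList (addColumnᵛ l w) ⟩
  inversions (toList (addColumnᵛ l w))             ≡⟨ cong inversions (toList-addColumnᵛ l w) ⟩
  inversions (addColumn l (toList w))              ≡⟨ inversions-addColumn l (toList w) (l≤length-toList w l≤k) ⟩
  inversions (toList w) + (length (toList w) ∸ l)  ≡⟨ cong₂ (λ i n → i + (n ∸ l)) (sym (inv-toList w)) (length-toList w) ⟩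
  inv w + (k + k ∸ l)                              ∎

firstColumnAt-addColumnᵛ : ∀ {k} l (w : Vec (Fin k) (k + k)) → l ≤ k →
  firstColumnAt l (toList (addColumnᵛ l w)) ≡ true
firstColumnAt-addColumnᵛ l w l≤k = trans (cong (firstColumnAt l) (toList-addColumnᵛ l w))
  (firstColumnAt-addColumn l (toList w) (l≤length-toList w l≤k))

ofDegree : (k : ℕ) → List ℕ → ℕ → Vec (Fin k) (k + k) → Bool
ofDegree k λ′ d v = isDellac k λ′ v ∧ (inv v ≡ᵇ d)

count-notInFirstColumn : ∀ {k} λ′ d → length λ′ ≤ k →
  count (λ v → ofDegree (suc k) λ′ d v ∧ not (firstColumnAt (length λ′) (toList v))) (allVecs (suc k) (suc k + suc k))
    ≡ DellacCoeff (suc k) (λ′ ⊕1) d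
count-notInFirstColumn {k} λ′ d l≤k = count-cong
  (λ v → trans (∧.xy∙z≈xz∙y (isDellac (suc k) λ′ v) _ _) (cong (_∧ (inv v ≡ᵇ d)) (sym (isDellac-⊕1 λ′ v l≤k))))
  (allVecs (suc k) (suc k + suc k))

count-inFirstColumn : ∀ {k} λ′ d → 1 ≤ k → length λ′ ≤ k →
  count (λ v → ofDegree (suc k) λ′ d v ∧ firstColumnAt (length λ′) (toList v)) (allVecs (suc k) (suc k + suc k))
    ≡ count (λ w → isDellac k (minus1 λ′) w ∧ (inv w + (k + k ∸ length λ′) ≡ᵇ d)) (allVecs k (k + k))
count-inFirstColumn {k} λ′ d 1≤k l≤k = count-bijection _ _ (addColumnᵛ l)
  (allVecs-unique (suc k) (suc k + suc k)) ∈-allVecs (allVecs-unique k (k + k)) ∈-allVecs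
  (addColumnᵛ-injective l _ _) image preimage
  where
  l = length λ′
  image : ∀ w → ofDegree (suc k) λ′ d (addColumnᵛ l w) ∧ firstColumnAt l (toList (addColumnᵛ l w))
                ≡ isDellac k (minus1 λ′) w ∧ (inv w + (k + k ∸ l) ≡ᵇ d)
  image w = trans
    (cong₂ _∧_ (cong₂ _∧_ (isDellac-addColumnᵛ λ′ w l≤k) (cong (_≡ᵇ d) (inv-addColumnᵛ l w l≤k)))
               (firstColumnAt-addColumnᵛ l w l≤k))
    (∧-identityʳ _)
  preimage : ∀ v → ofDegree (suc k) λ′ d v ∧ firstColumnAt l (toList v) ≡ true → ∃ λ w → addColumnᵛ l w ≡ v
  preimage v h = addColumnᵛ-surjective λ′ v 1≤k l≤k (∧-conicalˡ _ _ (∧-conicalˡ _ _ h)) (∧-conicalʳ _ _ h)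

2*suc∸2 : ∀ k → 2 * suc k ∸ 2 ≡ k + k
2*suc∸2 k = trans (sym (*-distribˡ-∸ 2 (suc k) 1)) (cong (k +_) (+-identityʳ k))

lemma7p13 : (n : ℕ) → 2 ≤ n → (λ' : List ℕ) → IsPartition λ' →
    length λ' ≤ n ∸ 1 → (∀ m → 0 < m → multiplicity m λ' ≤ 2) →
    ∀ d → DellacCoeff n λ' d
      ≡ DellacCoeff n (λ' ⊕1) d
        + qShift (2 * n ∸ 2 ∸ length λ') (DellacCoeff (n ∸ 1) (minus1 λ')) d
lemma7p13 (suc k) (s≤s 1≤k) λ′ _ l≤k _ d = begin
  DellacCoeff (suc k) λ′ d
    ≡⟨ count-partition counted inFirstColumn vs ⟩
  count (λ v → counted v ∧ not (inFirstColumn v)) vs + count (λ v → counted v ∧ inFirstColumn v) vs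
    ≡⟨ cong₂ _+_ (count-notInFirstColumn λ′ d l≤k) (count-inFirstColumn λ′ d 1≤k l≤k) ⟩
  C⊕1 + count (λ w → isDellac k λ⁻ w ∧ (inv w + (k + k ∸ l) ≡ᵇ d)) (allVecs k (k + k))
    ≡⟨ cong (C⊕1 +_) (count-qShift (isDellac k λ⁻) inv (k + k ∸ l) d (allVecs k (k + k))) ⟩
  C⊕1 + qShift (k + k ∸ l) (DellacCoeff k λ⁻) d
    ≡⟨ cong (λ a → C⊕1 + qShift (a ∸ l) (DellacCoeff k λ⁻) d) (2*suc∸2 k) ⟨
  C⊕1 + qShift (2 * suc k ∸ 2 ∸ l) (DellacCoeff k λ⁻) d
    ∎
  where
  l = length λ′
  λ⁻ = minus1 λ′
  C⊕1 = DellacCoeff (suc k) (λ′ ⊕1) d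
  vs = allVecs (suc k) (suc k + suc k)
  counted = ofDegree (suc k) λ′ d
  inFirstColumn : Vec (Fin (suc k)) (suc k + suc k) → Bool
  inFirstColumn v = firstColumnAt l (toList v)
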